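{- Let $k_1,k_2,k_3\in\mathbb{Z}_{\geq 0}$. Every number appearing as a component of some vertex of the tree $\mathbb{T}^{k_1,k_2,k_3}$ appears as the maximal component of some positive integer solution of \[x^2+y^2+z^2+k_1xy+k_2yz+k_3zx=(3+k_1+k_2+k_3)xyz.\]
   Context: The tree $\mathbb{T}^{k_1,k_2,k_3}$ has triplets of positive integers as vertices and is built as follows. (1) The root vertex is $(1,1,1)$. (2) The root has exactly three children: $(k_2+2,1,1)$, $(1,k_3+2,1)$, $(1,1,k_1+2)$. (3) Every vertex $(a,b,c)$ other than the root has exactly two children: (i) if $a$ is the maximal number in $(a,b,c)$, the children are $\left(a,\frac{a^2+k_3ac+c^2}{b},c\right)$ and $\left(a,b,\frac{a^2+k_1ab+b^2}{c}\right)$; (ii) if $b$ is maximal, the children are $\left(\frac{b^2+k_2bc+c^2}{a},b,c\right)$ and $\left(a,b,\frac{a^2+k_1ab+b^2}{c}\right)$; (iii) if $c$ is maximal, the children are $\left(\frac{b^2+k_2bc+c^2}{a},b,c\right)$ and $\left(a,\frac{a^2+k_3ac+c^2}{b},c\right)$. -}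

module Defs where

open import Data.Nat using (ℕ; zero; suc; _+_; _*_; _≤_; _/_; _⊔_)
open import Data.Product using (_×_)
open import Relation.Nullary using (¬_)

-- Exact-division helper: n ÷ d is the (floor) quotient n / d for d > 0.
-- All vertex components of the tree are positive integers and the
-- quotients in the tree rule are exact (as stated in the paper), so this
-- is the paper's division; the d = 0 clause is never used on tree vertices.
_÷_ : ℕ → ℕ → ℕ
n ÷ zero    = 0
n ÷ suc d   = n / suc d

Q : ℕ → ℕ → ℕ → ℕ
Q k u v = u * u + k * u * v + v * v

AMax : ℕ → ℕ → ℕ → Set
AMax a b c = (b ≤ a) × (c ≤ a)

BMax : ℕ → ℕ → ℕ → Set
BMax a b c = (a ≤ b) × (c ≤ b)

CMax : ℕ → ℕ → ℕ → Set
CMax a b c = (a ≤ c) × (b ≤ c)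

-- Non-root vertices of the tree T^{k1,k2,k3}.
-- Cases (i),(ii),(iii) are applied in this order of priority when
-- several components are tied for the maximum.
data NonRoot (k₁ k₂ k₃ : ℕ) : ℕ → ℕ → ℕ → Set where
  child₁ : NonRoot k₁ k₂ k₃ (k₂ + 2) 1 1
  child₂ : NonRoot k₁ k₂ k₃ 1 (k₃ + 2) 1
  child₃ : NonRoot k₁ k₂ k₃ 1 1 (k₁ + 2)
  iL : ∀ {a b c} → NonRoot k₁ k₂ k₃ a b c → AMax a b c →
       NonRoot k₁ k₂ k₃ a (Q k₃ a c ÷ b) c
  iR : ∀ {a b c} → NonRoot k₁ k₂ k₃ a b c → AMax a b c →
       NonRoot k₁ k₂ k₃ a b (Q k₁ a b ÷ c)
  iiL : ∀ {a b c} → NonRoot k₁ k₂ k₃ a b c → ¬ AMax a b c → BMax a b c →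
        NonRoot k₁ k₂ k₃ (Q k₂ b c ÷ a) b c
  iiR : ∀ {a b c} → NonRoot k₁ k₂ k₃ a b c → ¬ AMax a b c → BMax a b c →
        NonRoot k₁ k₂ k₃ a b (Q k₁ a b ÷ c)
  iiiL : ∀ {a b c} → NonRoot k₁ k₂ k₃ a b c → ¬ AMax a b c → ¬ BMax a b c →
         CMax a b c → NonRoot k₁ k₂ k₃ (Q k₂ b c ÷ a) b c
  iiiR : ∀ {a b c} → NonRoot k₁ k₂ k₃ a b c → ¬ AMax a b c → ¬ BMax a b c →
         CMax a b c → NonRoot k₁ k₂ k₃ a (Q k₃ a c ÷ b) c

data Vertex (k₁ k₂ k₃ : ℕ) : ℕ → ℕ → ℕ → Set where
  root    : Vertex k₁ k₂ k₃ 1 1 1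
  nonroot : ∀ {a b c} → NonRoot k₁ k₂ k₃ a b c → Vertex k₁ k₂ k₃ a b c

data IsComponent (n : ℕ) : ℕ → ℕ → ℕ → Set where
  comp₁ : ∀ {b c} → IsComponent n n b c
  comp₂ : ∀ {a c} → IsComponent n a n c
  comp₃ : ∀ {a b} → IsComponent n a b n

IsSolution : ℕ → ℕ → ℕ → ℕ → ℕ → ℕ → Set
IsSolution k₁ k₂ k₃ x y z =
  x * x + y * y + z * z + k₁ * x * y + k₂ * y * z + k₃ * z * x
    ≡ (3 + k₁ + k₂ + k₃) * x * y * z
  where open import Relation.Binary.PropositionalEquality using (_≡_)

-- Each vertex of the tree is a positive solution, and each child replaces
-- one component by its Vieta conjugate: the equation is monic quadratic in
-- that component, so the two roots x and x′ satisfy x·x′ = P, where P is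
-- the constant term. Since P is at least the square of the largest
-- component M of the parent, x ≤ M forces x′ ≥ M, so the new component is
-- the maximum of the new solution. By induction on the tree, every
-- component of every vertex is the maximum of some vertex.
module Submission where

open import Defs
open import Data.Nat using (ℕ; suc; _+_; _*_; _<_; _≤_; _⊔_; >-nonZero)
open import Data.Nat.Properties
open import Data.Nat.Divisibility using (_∣_; ∣m+n∣m⇒∣n; m∣m*n)
open import Data.Nat.DivMod using (m*[n/m]≡n; n/1≡n)
open import Data.Nat.Tactic.RingSolver using (solve)
open import Data.List using (_∷_; [])
open import Data.Product using (Σ; _×_; _,_; proj₁; proj₂)
open import Relation.Binary.PropositionalEquality
  using (_≡_; refl; sym; trans; cong; subst; module ≡-Reasoning)

conjugate-root : ∀ {L P R x x′} → 0 < x → x * x′ ≡ P →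
                 x * x + x * L + P ≡ x * R → x′ * x′ + x′ * L + P ≡ x′ * R
conjugate-root {L} {P} {R} {x} {x′} 0<x x*x′≡P x-is-root = begin
  x′ * x′ + x′ * L + P      ≡⟨ cong (x′ * x′ + x′ * L +_) (sym x*x′≡P) ⟩
  x′ * x′ + x′ * L + x * x′ ≡⟨ solve (x ∷ L ∷ x′ ∷ []) ⟩
  x′ * (x + L + x′)         ≡⟨ cong (x′ *_) sum-of-roots ⟩
  x′ * R                    ∎
  where
  open ≡-Reasoning
  sum-of-roots : x + L + x′ ≡ R
  sum-of-roots = *-cancelˡ-≡ (x + L + x′) R x {{>-nonZero 0<x}} (begin
    x * (x + L + x′)       ≡⟨ solve (x ∷ L ∷ x′ ∷ []) ⟩
    x * x + x * L + x * x′ ≡⟨ cong (x * x + x * L +_) x*x′≡P ⟩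
    x * x + x * L + P      ≡⟨ x-is-root ⟩
    x * R                  ∎)

root-divides-constant : ∀ {L P R x} → 0 < x → x * x + x * L + P ≡ x * R → x * (P ÷ x) ≡ P
root-divides-constant {L} {P} {R} {x@(suc _)} _ x-is-root = m*[n/m]≡n
  (∣m+n∣m⇒∣n (subst (x ∣_) (sym x-is-root) (m∣m*n R))
             (subst (x ∣_) (*-distribˡ-+ x x L) (m∣m*n (x + L))))

vieta-jump : ∀ {L P R x} (f g : ℕ → ℕ) →
             (∀ t → f t ≡ t * t + t * L + P) → (∀ t → g t ≡ t * R) →
             0 < x → f x ≡ g x → x * (P ÷ x) ≡ P × f (P ÷ x) ≡ g (P ÷ x)
vieta-jump {L} {P} {R} {x} f g f≡ g≡ 0<x fx≡gx =
  x*x′≡P , trans (f≡ x′) (trans (conjugate-root 0<x x*x′≡P x-is-root) (sym (g≡ x′)))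
  where
  x′ = P ÷ x
  x-is-root : x * x + x * L + P ≡ x * R
  x-is-root = trans (sym (f≡ x)) (trans fx≡gx (g≡ x))
  x*x′≡P : x * x′ ≡ P
  x*x′≡P = root-divides-constant 0<x x-is-root

conjugate-root-≥ : ∀ {x x′ P M} → 0 < x → x * x′ ≡ P → M * M ≤ P → x ≤ M → M ≤ x′
conjugate-root-≥ {x} {x′} {P} {M} 0<x x*x′≡P M*M≤P x≤M =
  *-cancelˡ-≤ x {{>-nonZero 0<x}} (begin
    x * M  ≤⟨ *-monoˡ-≤ M x≤M ⟩
    M * M  ≤⟨ M*M≤P ⟩
    P      ≡⟨ sym x*x′≡P ⟩
    x * x′ ∎)
  where open ≤-Reasoning

square-left≤Q : ∀ k u v → u * u ≤ Q k u v
square-left≤Q k u v = ≤-trans (m≤m+n (u * u) (k * u * v)) (m≤m+n _ (v * v))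

square-right≤Q : ∀ k u v → v * v ≤ Q k u v
square-right≤Q k u v = m≤n+m (v * v) _

a≡a⊔b⊔c : ∀ {a b c} → b ≤ a → c ≤ a → a ≡ a ⊔ b ⊔ c
a≡a⊔b⊔c {a} {b} {c} b≤a c≤a = sym (trans (cong (_⊔ c) (m≥n⇒m⊔n≡m b≤a)) (m≥n⇒m⊔n≡m c≤a))

b≡a⊔b⊔c : ∀ {a b c} → a ≤ b → c ≤ b → b ≡ a ⊔ b ⊔ c
b≡a⊔b⊔c {a} {b} {c} a≤b c≤b = sym (trans (cong (_⊔ c) (m≤n⇒m⊔n≡n a≤b)) (m≥n⇒m⊔n≡m c≤b))

c≡a⊔b⊔c : ∀ {a b c} → a ≤ c → b ≤ c → c ≡ a ⊔ b ⊔ c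
c≡a⊔b⊔c a≤c b≤c = sym (m≤n⇒m⊔n≡n (⊔-lub a≤c b≤c))

module _ (k₁ k₂ k₃ : ℕ) where

  lhs rhs : ℕ → ℕ → ℕ → ℕ
  lhs x y z = x * x + y * y + z * z + k₁ * x * y + k₂ * y * z + k₃ * z * x
  rhs x y z = (3 + k₁ + k₂ + k₃) * x * y * z

  -- Stated with lhs and Q unfolded: the ring solver treats defined functions as atoms.
  lhs-in-a : ∀ a b c → a * a + b * b + c * c + k₁ * a * b + k₂ * b * c + k₃ * c * a
                     ≡ a * a + a * (k₁ * b + k₃ * c) + (b * b + k₂ * b * c + c * c)
  lhs-in-a a b c = solve (a ∷ b ∷ c ∷ k₁ ∷ k₂ ∷ k₃ ∷ [])

  lhs-in-b : ∀ a b c → a * a + b * b + c * c + k₁ * a * b + k₂ * b * c + k₃ * c * a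
                     ≡ b * b + b * (k₁ * a + k₂ * c) + (a * a + k₃ * a * c + c * c)
  lhs-in-b a b c = solve (a ∷ b ∷ c ∷ k₁ ∷ k₂ ∷ k₃ ∷ [])

  lhs-in-c : ∀ a b c → a * a + b * b + c * c + k₁ * a * b + k₂ * b * c + k₃ * c * a
                     ≡ c * c + c * (k₂ * b + k₃ * a) + (a * a + k₁ * a * b + b * b)
  lhs-in-c a b c = solve (a ∷ b ∷ c ∷ k₁ ∷ k₂ ∷ k₃ ∷ [])

  rhs-in-a : ∀ a b c → (3 + k₁ + k₂ + k₃) * a * b * c ≡ a * ((3 + k₁ + k₂ + k₃) * b * c)
  rhs-in-a a b c = solve (a ∷ b ∷ c ∷ k₁ ∷ k₂ ∷ k₃ ∷ [])

  rhs-in-b : ∀ a b c → (3 + k₁ + k₂ + k₃) * a * b * c ≡ b * ((3 + k₁ + k₂ + k₃) * a * c)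
  rhs-in-b a b c = solve (a ∷ b ∷ c ∷ k₁ ∷ k₂ ∷ k₃ ∷ [])

  rhs-in-c : ∀ a b c → (3 + k₁ + k₂ + k₃) * a * b * c ≡ c * ((3 + k₁ + k₂ + k₃) * a * b)
  rhs-in-c a b c = solve (a ∷ b ∷ c ∷ k₁ ∷ k₂ ∷ k₃ ∷ [])

  record PositiveSolution (x y z : ℕ) : Set where
    field
      x-pos : 0 < x
      y-pos : 0 < y
      z-pos : 0 < z
      equation : IsSolution k₁ k₂ k₃ x y z

  MaxOfPositiveSolution : ℕ → Set
  MaxOfPositiveSolution n = Σ ℕ λ x → Σ ℕ λ y → Σ ℕ λ z →
    (0 < x) × (0 < y) × (0 < z) × IsSolution k₁ k₂ k₃ x y z × (n ≡ x ⊔ y ⊔ z)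

  max-of : ∀ {x y z n} → PositiveSolution x y z → n ≡ x ⊔ y ⊔ z → MaxOfPositiveSolution n
  max-of {x} {y} {z} s n≡max = x , y , z , x-pos , y-pos , z-pos , equation , n≡max
    where open PositiveSolution s

  record TreeInvariant (a b c : ℕ) : Set where
    field
      solution : PositiveSolution a b c
      maxima   : ∀ {n} → IsComponent n a b c → MaxOfPositiveSolution n
  open TreeInvariant

  root-solution : PositiveSolution 1 1 1
  root-solution = record
    { x-pos = ≤-refl ; y-pos = ≤-refl ; z-pos = ≤-refl ; equation = solve (k₁ ∷ k₂ ∷ k₃ ∷ []) }

  root-invariant : TreeInvariant 1 1 1
  root-invariant = record
    { solution = root-solution
    ; maxima   = λ { comp₁ → one ; comp₂ → one ; comp₃ → one }
    }
    where
    one : MaxOfPositiveSolution 1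
    one = max-of root-solution refl

  mutate-a : ∀ {a b c M} → TreeInvariant a b c → a ≤ M → b ≤ M → c ≤ M → M * M ≤ Q k₂ b c →
           TreeInvariant (Q k₂ b c ÷ a) b c
  mutate-a {a} {b} {c} {M} r a≤M b≤M c≤M M*M≤P = record
    { solution = solution′
    ; maxima   = λ { comp₁ → max-of solution′ (a≡a⊔b⊔c (≤-trans b≤M M≤a′) (≤-trans c≤M M≤a′))
                   ; comp₂ → maxima r comp₂
                   ; comp₃ → maxima r comp₃ }
    }
    where
    open PositiveSolution (solution r)
    jump = vieta-jump (λ t → lhs t b c) (λ t → rhs t b c)
                      (λ t → lhs-in-a t b c) (λ t → rhs-in-a t b c) x-pos equation
    M≤a′ : M ≤ Q k₂ b c ÷ a
    M≤a′ = conjugate-root-≥ x-pos (proj₁ jump) M*M≤P a≤M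
    solution′ = record { x-pos = <-≤-trans x-pos (≤-trans a≤M M≤a′) ; y-pos = y-pos ; z-pos = z-pos
                       ; equation = proj₂ jump }

  mutate-b : ∀ {a b c M} → TreeInvariant a b c → a ≤ M → b ≤ M → c ≤ M → M * M ≤ Q k₃ a c →
           TreeInvariant a (Q k₃ a c ÷ b) c
  mutate-b {a} {b} {c} {M} r a≤M b≤M c≤M M*M≤P = record
    { solution = solution′
    ; maxima   = λ { comp₁ → maxima r comp₁
                   ; comp₂ → max-of solution′ (b≡a⊔b⊔c (≤-trans a≤M M≤b′) (≤-trans c≤M M≤b′))
                   ; comp₃ → maxima r comp₃ }
    }
    where
    open PositiveSolution (solution r)
    jump = vieta-jump (λ t → lhs a t c) (λ t → rhs a t c)
                      (λ t → lhs-in-b a t c) (λ t → rhs-in-b a t c) y-pos equation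
    M≤b′ : M ≤ Q k₃ a c ÷ b
    M≤b′ = conjugate-root-≥ y-pos (proj₁ jump) M*M≤P b≤M
    solution′ = record { x-pos = x-pos ; y-pos = <-≤-trans y-pos (≤-trans b≤M M≤b′) ; z-pos = z-pos
                       ; equation = proj₂ jump }

  mutate-c : ∀ {a b c M} → TreeInvariant a b c → a ≤ M → b ≤ M → c ≤ M → M * M ≤ Q k₁ a b →
           TreeInvariant a b (Q k₁ a b ÷ c)
  mutate-c {a} {b} {c} {M} r a≤M b≤M c≤M M*M≤P = record
    { solution = solution′
    ; maxima   = λ { comp₁ → maxima r comp₁
                   ; comp₂ → maxima r comp₂
                   ; comp₃ → max-of solution′ (c≡a⊔b⊔c (≤-trans a≤M M≤c′) (≤-trans b≤M M≤c′)) }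
    }
    where
    open PositiveSolution (solution r)
    jump = vieta-jump (λ t → lhs a b t) (λ t → rhs a b t)
                      (λ t → lhs-in-c a b t) (λ t → rhs-in-c a b t) z-pos equation
    M≤c′ : M ≤ Q k₁ a b ÷ c
    M≤c′ = conjugate-root-≥ z-pos (proj₁ jump) M*M≤P c≤M
    solution′ = record { x-pos = x-pos ; y-pos = y-pos ; z-pos = <-≤-trans z-pos (≤-trans c≤M M≤c′)
                       ; equation = proj₂ jump }

  Q11÷1≡k+2 : ∀ k → Q k 1 1 ÷ 1 ≡ k + 2
  Q11÷1≡k+2 k = trans (n/1≡n (Q k 1 1)) Q11≡k+2
    where
    Q11≡k+2 : 1 * 1 + k * 1 * 1 + 1 * 1 ≡ k + 2
    Q11≡k+2 = solve (k ∷ [])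

  nonroot-invariant : ∀ {a b c} → NonRoot k₁ k₂ k₃ a b c → TreeInvariant a b c
  nonroot-invariant child₁ = subst (λ t → TreeInvariant t 1 1) (Q11÷1≡k+2 k₂)
    (mutate-a root-invariant ≤-refl ≤-refl ≤-refl (square-left≤Q k₂ 1 1))
  nonroot-invariant child₂ = subst (λ t → TreeInvariant 1 t 1) (Q11÷1≡k+2 k₃)
    (mutate-b root-invariant ≤-refl ≤-refl ≤-refl (square-left≤Q k₃ 1 1))
  nonroot-invariant child₃ = subst (λ t → TreeInvariant 1 1 t) (Q11÷1≡k+2 k₁)
    (mutate-c root-invariant ≤-refl ≤-refl ≤-refl (square-left≤Q k₁ 1 1))
  nonroot-invariant (iL {a} {b} {c} v (b≤a , c≤a)) =
    mutate-b (nonroot-invariant v) ≤-refl b≤a c≤a (square-left≤Q k₃ a c)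
  nonroot-invariant (iR {a} {b} v (b≤a , c≤a)) =
    mutate-c (nonroot-invariant v) ≤-refl b≤a c≤a (square-left≤Q k₁ a b)
  nonroot-invariant (iiL {b = b} {c} v _ (a≤b , c≤b)) =
    mutate-a (nonroot-invariant v) a≤b ≤-refl c≤b (square-left≤Q k₂ b c)
  nonroot-invariant (iiR {a} {b} v _ (a≤b , c≤b)) =
    mutate-c (nonroot-invariant v) a≤b ≤-refl c≤b (square-right≤Q k₁ a b)
  nonroot-invariant (iiiL {b = b} {c} v _ _ (a≤c , b≤c)) =
    mutate-a (nonroot-invariant v) a≤c b≤c ≤-refl (square-right≤Q k₂ b c)
  nonroot-invariant (iiiR {a} {c = c} v _ _ (a≤c , b≤c)) =
    mutate-b (nonroot-invariant v) a≤c b≤c ≤-refl (square-right≤Q k₃ a c)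

  vertex-invariant : ∀ {a b c} → Vertex k₁ k₂ k₃ a b c → TreeInvariant a b c
  vertex-invariant root        = root-invariant
  vertex-invariant (nonroot v) = nonroot-invariant v

corollary2p7 : (k₁ k₂ k₃ : ℕ) → ∀ {a b c : ℕ} → Vertex k₁ k₂ k₃ a b c →
    (n : ℕ) → IsComponent n a b c →
    Σ ℕ λ x → Σ ℕ λ y → Σ ℕ λ z →
      (0 < x) × (0 < y) × (0 < z) × IsSolution k₁ k₂ k₃ x y z × (n ≡ x ⊔ y ⊔ z)
corollary2p7 k₁ k₂ k₃ v n = TreeInvariant.maxima (vertex-invariant k₁ k₂ k₃ v)
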